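{- Fix an integer $b\ge2$ and a nonempty set $S\subseteq\mathbb{Z}$. All $b$-orderings $\mathbf{a}$ of $S$ give the same values $\alpha_k(S,b,\mathbf{a})$ for each $k\ge1$; denoting this common value by $\alpha_k(S,b)$, one has $$\alpha_k(S,b)=\alpha_k(\varphi_b(S))\quad\text{for all }k\ge1,$$ where $\alpha_k(\varphi_b(S))$ is the $t$-exponent sequence of the subset $\varphi_b(S)=\{\varphi_b(a):a\in S\}$ of $\mathbb{Q}[[t]]$.
   Context: For $a\in\mathbb{Z}$, $\operatorname{ord}_b(a):=\sup\{k\in\mathbb{N}: b^k\mid a\}$. A $b$-ordering of $S$ is an infinite sequence $\mathbf{a}=(a_i)_{i\ge0}$ in $S$ such that for each $i\ge1$, $\sum_{j<i}\operatorname{ord}_b(a_i-a_j)=\min_{a'\in S}\sum_{j<i}\operatorname{ord}_b(a'-a_j)$; and $\alpha_k(S,b,\mathbf{a}):=\sum_{j<k}\operatorname{ord}_b(a_k-a_j)$. The map $\varphi_b:\mathbb{Z}\to\mathbb{Q}[[t]]$ is $\varphi_b(a):=\sum_{k\ge0}d_k(a,b)t^k$ with $d_k(a,b):=\lfloor a/b^k\rfloor-b\lfloor a/b^{k+1}\rfloor$. On $\mathbb{Q}[[t]]$, $\operatorname{ord}_t$ is the $t$-adic valuation; a $t$-ordering of nonempty $U\subseteq\mathbb{Q}[[t]]$ is a sequence $(f_i)_{i\ge0}$ in $U$ with $f_0$ arbitrary and each $f_k$ ($k\ge1$) minimizing $\sum_{j<k}\operatorname{ord}_t(f_k-f_j)$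 over $U$; $\alpha_k(U):=\sum_{j<k}\operatorname{ord}_t(f_k-f_j)$, which is independent of the choice of $t$-ordering. -}

module Defs where

open import Data.Nat as ℕ using (ℕ; zero; suc; NonZero)
import Data.Nat.Properties as ℕP
open import Data.Integer as ℤ using (ℤ; +_; _/ℕ_)
import Data.Integer.Divisibility as ℤD
open import Data.Rational as ℚ using (ℚ; 0ℚ)
open import Data.Product using (Σ; ∃; _×_; _,_)
open import Data.Unit using (⊤)
open import Relation.Binary.PropositionalEquality using (_≡_)
open import Relation.Nullary using (¬_)

-- Extended naturals ℕ ∪ {∞}, encoded by their sets of upper bounds:
-- an element x is represented by the predicate  (x ≤ n)  on n : ℕ.
-- (∞ is the empty predicate.)  This encoding is needed because the
-- t-adic valuation of a power series over ℚ is not computable.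

ℕ∞ : Set₁
ℕ∞ = ℕ → Set

_≤∞_ : ℕ∞ → ℕ∞ → Set
x ≤∞ y = ∀ n → y n → x n

_≈∞_ : ℕ∞ → ℕ∞ → Set
x ≈∞ y = (x ≤∞ y) × (y ≤∞ x)

0∞ : ℕ∞
0∞ n = ⊤

_+∞_ : ℕ∞ → ℕ∞ → ℕ∞
(x +∞ y) n = Σ ℕ λ i → Σ ℕ λ j → x i × y j × (i ℕ.+ j) ℕ.≤ n

sum∞ : ℕ → (ℕ → ℕ∞) → ℕ∞
sum∞ zero    g = 0∞
sum∞ (suc k) g = sum∞ k g +∞ g k

-- ord_b(a) = sup { k ∈ ℕ : b^k ∣ a }  (= ∞ when a = 0):
-- sup ≤ n  iff  every k with b^k ∣ a satisfies k ≤ n.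

ordb : ℕ → ℤ → ℕ∞
ordb b a n = ∀ k → ((+ b) ℤ.^ k) ℤD.∣ a → k ℕ.≤ n

bsum : ℕ → (ℕ → ℤ) → ℕ → ℤ → ℕ∞
bsum b a i x = sum∞ i (λ j → ordb b (x ℤ.- a j))

αb : ℕ → (ℕ → ℤ) → ℕ → ℕ∞
αb b a k = bsum b a k (a k)

IsBOrdering : ℕ → (ℤ → Set) → (ℕ → ℤ) → Set
IsBOrdering b S a =
  (∀ i → S (a i)) ×
  (∀ i → 1 ℕ.≤ i → ∀ x → S x → bsum b a i (a i) ≤∞ bsum b a i x)

PS : Set
PS = ℕ → ℚ

_-ps_ : PS → PS → PS
(f -ps g) k = f k ℚ.- g k

tPowDivides : ℕ → PS → Set
tPowDivides k f = ∀ i → i ℕ.< k → f i ≡ 0ℚ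

ordt : PS → ℕ∞
ordt f n = ∀ k → tPowDivides k f → k ℕ.≤ n

tsum : (ℕ → PS) → ℕ → PS → ℕ∞
tsum f i g = sum∞ i (λ j → ordt (g -ps f j))

αt : (ℕ → PS) → ℕ → ℕ∞
αt f k = tsum f k (f k)

IsTOrdering : (PS → Set) → (ℕ → PS) → Set
IsTOrdering U f =
  (∀ i → U (f i)) ×
  (∀ k → 1 ℕ.≤ k → ∀ g → U g → tsum f k (f k) ≤∞ tsum f k g)

-- φ_b(a) = Σ_k d_k(a,b) t^k, d_k(a,b) = ⌊a/b^k⌋ − b ⌊a/b^(k+1)⌋.
-- _/ℕ_ is floor division for a positive divisor.

private
  nz : ∀ {b} → 2 ℕ.≤ b → NonZero b
  nz (ℕ.s≤s _) = _

  nzPow : ∀ {b} → 2 ℕ.≤ b → ∀ k → NonZero (b ℕ.^ k)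
  nzPow hb k = ℕP.m^n≢0 _ k {{nz hb}}

floorDiv : (b : ℕ) → 2 ℕ.≤ b → ℤ → ℕ → ℤ
floorDiv b hb a k = _/ℕ_ a (b ℕ.^ k) {{nzPow hb k}}

digit : (b : ℕ) → 2 ℕ.≤ b → ℤ → ℕ → ℤ
digit b hb a k = floorDiv b hb a k ℤ.- (+ b) ℤ.* floorDiv b hb a (suc k)

φ : (b : ℕ) → 2 ℕ.≤ b → ℤ → PS
φ b hb a k = digit b hb a k ℚ./ 1

-- the image φ_b(S) ⊆ ℚ[[t]]; membership up to coefficientwise equality
image : (b : ℕ) → 2 ℕ.≤ b → (ℤ → Set) → PS → Set
image b hb S f = ∃ λ a → S a × (∀ k → f k ≡ φ b hb a k)

-- A b-ordering is a greedy ordering for the closeness ord_b(x − y) of integers, which is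
-- ultrametric: ord_b(x − z) ≥ min(ord_b(x − y), ord_b(y − z)).  For any such closeness, if
-- a₀, …, a_k is greedy then every list Y of k points has some a_i with Σ_{y ∈ Y} ord(a_i − y)
-- at most α_k; applied to the first k terms of a second b-ordering this bounds its α_k by ours,
-- so all b-orderings share the same α_k.  That lemma is proved by induction on k: if m is the
-- least closeness of a₀ to the sequence, the terms split into the ball {closeness to a₀ > m}
-- and the rest, any two terms from different parts are at closeness exactly m, and Y has fewer
-- points near one of the parts than that part has terms, so induction applies to that part
-- with m subtracted from the closeness.  Deciding α_k ≤ n only needs valuations truncated at
-- n + 1, which makes the argument finite.
--
-- For the second claim, t^k ∣ φ_b(x) − φ_b(y) iff the lowest k base-b digits of x and y agree,
-- iff b^k ∣ x − y.  Hence ord_t(φ_b(x) − φ_b(y)) = ord_b(x − y), so preimages of a t-ordering of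
-- φ_b(S) form a b-ordering of S with the same exponents.

module Submission where

open import Data.Integer as ℤ using (ℤ)
open import Data.Integer.DivMod using (_/ℕ_; _%ℕ_; a≡a%ℕn+[a/ℕn]*n; [n/ℕd]*d≤n; n<s[n/ℕd]*d; n%ℕd<d)
import Data.Integer.Divisibility as ℤD
import Data.Integer.Divisibility.Signed as ℤS
import Data.Integer.Properties as ℤP
open import Data.Integer.Solver using (module +-*-Solver)
open import Data.List using (List; []; _∷_; _++_; _∷ʳ_; [_]; map; length; filter; applyUpTo)
open import Data.List.Extrema.Nat using (argmin; f[argmin]≤f[⊤]; f[argmin]≤f[xs]; argmin-all)
open import Data.List.Membership.Propositional using (_∈_; lose; find)
open import Data.List.Membership.Propositional.Properties
  using (∈-++⁺ˡ; ∈-++⁺ʳ; ∈-++⁻; ∈-filter⁺; ∈-filter⁻; ∈-applyUpTo⁻)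
open import Data.List.Properties
  using ( map-++; ++-assoc; ∷-injective; ∷ʳ-injective; length-++; filter-accept; filter-reject
        ; filter-some; length-applyUpTo; applyUpTo-∷ʳ; map-applyUpTo)
open import Data.List.Relation.Unary.All as All using (All; []; _∷_)
open import Data.List.Relation.Unary.Any using (Any; here; there; any?)
open import Data.List.Reverse using (reverseView; []; _∶_∶ʳ_)
open import Data.Nat
open import Data.Nat.Divisibility using (_∣_; _∣?_; _∣0; 1∣_; m∣m*n; ∣-trans)
open import Data.Nat.ListAction using (sum)
open import Data.Nat.ListAction.Properties using (sum-++)
open import Data.Nat.Properties
open import Data.Product using (∃; ∃₂; ∃-syntax; _×_; _,_; proj₁; proj₂)
import Data.Rational as ℚ
import Data.Rational.Properties as ℚP
open import Data.Rational.Unnormalised using (mkℚᵘ; *≡*)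
open import Data.Sum using (inj₁; inj₂)
open import Data.Unit using (tt)
open import Function using (_∘_)
open import Function.Bundles using (_⇔_; mk⇔; module Equivalence)
open import Relation.Binary.PropositionalEquality hiding ([_])
open import Relation.Nullary using (¬_; Dec; yes; no; contradiction)
open import Relation.Nullary.Decidable using (decidable-stable)
open import Relation.Unary using (Decidable; ∁)
open import Relation.Unary.Properties using (∁?)

open import Defs

open import Algebra.Properties.CommutativeSemigroup +-commutativeSemigroup using (interchange)
open import Algebra.Properties.Group ℚP.+-0-group using (x∙y⁻¹≈ε⇒x≈y; x≈y⇒x∙y⁻¹≈ε)
open Equivalence using (to; from)

private variable
  X : Set

filter-split : ∀ {K : X → Set} (K? : Decidable K) L {P′ c R′} → filter K? L ≡ P′ ++ c ∷ R′ →
               ∃₂ λ P R → L ≡ P ++ c ∷ R × filter K? P ≡ P′ × filter K? R ≡ R′ × K c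
filter-split K? [] {[]}    ()
filter-split K? [] {_ ∷ _} ()
filter-split K? (x ∷ L) {P′} eq with K? x
filter-split K? (x ∷ L) {[]}     eq | yes Kx with refl , refl ← ∷-injective eq =
  [] , L , refl , refl , refl , Kx
filter-split K? (x ∷ L) {_ ∷ P′} eq | yes Kx with refl , eq′ ← ∷-injective eq
  with P , R , refl , refl , refl , Kc ← filter-split K? L eq′ =
  x ∷ P , R , refl , filter-accept K? Kx , refl , Kc
filter-split K? (x ∷ L) eq | no ¬Kx with P , R , refl , refl , refl , Kc ← filter-split K? L eq =
  x ∷ P , R , refl , filter-reject K? ¬Kx , refl , Kc

length-filter-∁ : ∀ {K : X → Set} (K? : Decidable K) L →
                  length (filter K? L) + length (filter (∁? K?) L) ≡ length L
length-filter-∁ K? []      = refl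
length-filter-∁ K? (x ∷ L) with K? x
... | yes _ = cong suc (length-filter-∁ K? L)
... | no  _ = trans (+-suc _ _) (cong suc (length-filter-∁ K? L))

split-at : ∀ (L : List X) {q} → q < length L → ∃₂ λ P c → ∃ λ R → L ≡ P ++ c ∷ R × length P ≡ q
split-at (x ∷ L) {zero}  _        = [] , x , L , refl , refl
split-at (x ∷ L) {suc q} (s≤s q<) with P , c , R , refl , refl ← split-at L q< =
  x ∷ P , c , R , refl , refl

∈-∷ʳ⇒∈-++-∷ : ∀ {z : X} P {c} R → z ∈ P ∷ʳ c → z ∈ P ++ c ∷ R
∈-∷ʳ⇒∈-++-∷ P R z∈ with ∈-++⁻ P z∈
... | inj₁ z∈P         = ∈-++⁺ˡ z∈P
... | inj₂ (here refl) = ∈-++⁺ʳ P (here refl)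

applyUpTo-split : ∀ (f : ℕ → X) n {P x R} → applyUpTo f n ≡ P ++ x ∷ R →
  ∃[ i ] i < n × P ≡ applyUpTo f i × x ≡ f i × (∀ {z} → z ∈ R → ∃[ l ] i < l × l < n × z ≡ f l)
applyUpTo-split f zero    {[]}    ()
applyUpTo-split f zero    {_ ∷ _} ()
applyUpTo-split f (suc n) {[]} refl = 0 , s≤s z≤n , refl , refl , λ z∈ →
  let l , l<n , z≡ = ∈-applyUpTo⁻ (f ∘ suc) z∈ in suc l , s≤s z≤n , s≤s l<n , z≡
applyUpTo-split f (suc n) {_ ∷ P} eq with refl , eq′ ← ∷-injective eq
  with i , i<n , refl , refl , later ← applyUpTo-split (f ∘ suc) n eq′ = suc i , s≤s i<n , refl , refl , λ z∈ →
  let l , i<l , l<n , z≡ = later z∈ in suc l , s≤s i<l , s≤s l<n , z≡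

-- Greedy orderings for an ultrametric closeness

-- Larger values mean nearer points; the example is the truncated ord_b(x − y) below.
record IsCloseness (d : X → X → ℕ) : Set where
  field
    symmetric   : ∀ x y → d x y ≡ d y x
    ultrametric : ∀ x y z → d x y ⊓ d y z ≤ d x z
    ≤-diagonal  : ∀ x y → d x y ≤ d x x

_∸ᶜ_ : (X → X → ℕ) → ℕ → X → X → ℕ
(d ∸ᶜ m) x y = d x y ∸ m

isCloseness-∸ : ∀ {d : X → X → ℕ} m → IsCloseness d → IsCloseness (d ∸ᶜ m)
isCloseness-∸ {d = d} m c = record
  { symmetric   = λ x y → cong (_∸ m) (symmetric x y)
  ; ultrametric = λ x y z → ≤-trans (≤-reflexive (sym (∸-distribʳ-⊓ m (d x y) (d y z))))
                                     (∸-monoˡ-≤ m (ultrametric x y z))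
  ; ≤-diagonal  = λ x y → ∸-monoˡ-≤ m (≤-diagonal x y)
  }
  where open IsCloseness c

cost : (X → X → ℕ) → X → List X → ℕ
cost d z Y = sum (map (d z) Y)

module _ (d : X → X → ℕ) where

  cost-++ : ∀ z P Q → cost d z (P ++ Q) ≡ cost d z P + cost d z Q
  cost-++ z P Q = trans (cong sum (map-++ (d z) P Q)) (sum-++ (map (d z) P) (map (d z) Q))

  cost-≤-++ : ∀ z P Q → cost d z P ≤ cost d z (P ++ Q)
  cost-≤-++ z P Q = ≤-trans (m≤m+n _ _) (≤-reflexive (sym (cost-++ z P Q)))

  cost-≤-* : ∀ {z m} Y → All (λ y → d z y ≤ m) Y → cost d z Y ≤ length Y * m
  cost-≤-* []      []       = z≤n
  cost-≤-* (_ ∷ Y) (h ∷ hs) = +-mono-≤ h (cost-≤-* Y hs)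

  cost-∸ : ∀ z m Y → cost d z Y ≤ length Y * m + cost (d ∸ᶜ m) z Y
  cost-∸ z m []      = z≤n
  cost-∸ z m (y ∷ Y) = begin
    d z y + cost d z Y                                     ≤⟨ +-mono-≤ (m≤n+m∸n (d z y) m) (cost-∸ z m Y) ⟩
    (m + (d z y ∸ m)) + (length Y * m + cost (d ∸ᶜ m) z Y) ≡⟨ interchange m (d z y ∸ m) (length Y * m) _ ⟩
    (m + length Y * m) + ((d z y ∸ m) + cost (d ∸ᶜ m) z Y) ∎
    where open ≤-Reasoning

  cost-∸-exact : ∀ {z m} Y → All (λ y → m ≤ d z y) Y → cost d z Y ≡ length Y * m + cost (d ∸ᶜ m) z Y
  cost-∸-exact         []      []       = refl
  cost-∸-exact {z} {m} (y ∷ Y) (h ∷ hs) = begin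
    d z y + cost d z Y                                     ≡⟨ cong₂ _+_ (sym (m+[n∸m]≡n h)) (cost-∸-exact Y hs) ⟩
    (m + (d z y ∸ m)) + (length Y * m + cost (d ∸ᶜ m) z Y) ≡⟨ interchange m (d z y ∸ m) (length Y * m) _ ⟩
    (m + length Y * m) + ((d z y ∸ m) + cost (d ∸ᶜ m) z Y) ∎
    where open ≡-Reasoning

  cost-filter : ∀ {K : X → Set} (K? : Decidable K) {z} Y →
                (∀ {y} → y ∈ Y → ¬ K y → d z y ≡ 0) → cost d z (filter K? Y) ≡ cost d z Y
  cost-filter K? []      _ = refl
  cost-filter K? {z} (y ∷ Y) far with K? y
  ... | yes _  = cong (d z y +_) (cost-filter K? Y (far ∘ there))
  ... | no ¬Ky = trans (cost-filter K? Y (far ∘ there)) (cong (_+ cost d z Y) (sym (far (here refl) ¬Ky)))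

Greedy : (X → X → ℕ) → List X → Set
Greedy d L = ∀ P x R → L ≡ P ++ x ∷ R → ∀ {z} → z ∈ R → cost d x P ≤ cost d z P

Separated : (X → X → ℕ) → ℕ → (X → Set) → List X → Set
Separated d m K L = ∀ {z p} → z ∈ L → p ∈ L → K z → ¬ K p → d z p ≤ m

separated-∸ : ∀ {d : X → X → ℕ} {m K L} → Separated d m K L → Separated (d ∸ᶜ m) 0 K L
separated-∸ sep z∈ p∈ Kz ¬Kp = ≤-reflexive (m≤n⇒m∸n≡0 (sep z∈ p∈ Kz ¬Kp))

module _ (d : X → X → ℕ) where

  greedy-prefix : ∀ P c R → Greedy d (P ++ c ∷ R) → Greedy d (P ∷ʳ c)
  greedy-prefix P c R greedy P₁ x R₁ eq z∈R₁ = greedy P₁ x (R₁ ++ R) eq′ (∈-++⁺ˡ z∈R₁)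
    where
    open ≡-Reasoning
    eq′ : P ++ c ∷ R ≡ P₁ ++ x ∷ (R₁ ++ R)
    eq′ = begin
      P ++ c ∷ R          ≡⟨ ++-assoc P [ c ] R ⟨
      (P ∷ʳ c) ++ R       ≡⟨ cong (_++ R) eq ⟩
      (P₁ ++ x ∷ R₁) ++ R ≡⟨ ++-assoc P₁ (x ∷ R₁) R ⟩
      P₁ ++ x ∷ (R₁ ++ R) ∎

  greedy-∸ : ∀ {m L} → (∀ {z p} → z ∈ L → p ∈ L → m ≤ d z p) → Greedy d L → Greedy (d ∸ᶜ m) L
  greedy-∸ {m} m≤ greedy P x R refl z∈R =
    +-cancelˡ-≤ (length P * m) _ _
      (subst₂ _≤_ (cost-∸-exact d P (above (∈-++⁺ʳ P (here refl))))
                  (cost-∸-exact d P (above (∈-++⁺ʳ P (there z∈R))))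
                  (greedy P x R refl z∈R))
    where
    above : ∀ {u} → u ∈ P ++ x ∷ R → All (λ p → m ≤ d u p) P
    above u∈ = All.tabulate (λ p∈P → m≤ u∈ (∈-++⁺ˡ p∈P))

  greedy-filter : ∀ {K : X → Set} (K? : Decidable K) {L} → Separated d 0 K L → Greedy d L →
                  Greedy d (filter K? L)
  greedy-filter {K} K? {L} sep greedy P′ c R′ eq z∈R′
    with P , R , refl , refl , refl , Kc ← filter-split K? L eq
    with z∈R , Kz ← ∈-filter⁻ K? {xs = R} z∈R′ =
    subst₂ _≤_ (sym (restrict (∈-++⁺ʳ P (here refl)) Kc)) (sym (restrict (∈-++⁺ʳ P (there z∈R)) Kz))
      (greedy P c R refl z∈R)
    where
    restrict : ∀ {u} → u ∈ P ++ c ∷ R → K u → cost d u (filter K? P) ≡ cost d u P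
    restrict u∈ Ku = cost-filter d K? P (λ p∈P ¬Kp → n≤0⇒n≡0 (sep u∈ (∈-++⁺ˡ p∈P) Ku ¬Kp))

  greedy-≤-last : ∀ A x P c Q → Greedy d (A ∷ʳ x) → A ∷ʳ x ≡ P ++ c ∷ Q → cost d c P ≤ cost d x A
  greedy-≤-last A x P c Q greedy eq with reverseView Q
  ... | [] with refl , refl ← ∷ʳ-injective A P eq = ≤-refl
  ... | Q′ ∶ _ ∶ʳ q
    with refl , refl ← ∷ʳ-injective A (P ++ c ∷ Q′) (trans eq (sym (++-assoc P (c ∷ Q′) [ q ]))) =
    ≤-trans (greedy P c (Q′ ∷ʳ q) (++-assoc P (c ∷ Q′) [ q ]) (∈-++⁺ʳ Q′ (here refl)))
            (cost-≤-++ d q P (c ∷ Q′))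

  filter-greedy-≤-last : ∀ {K : X → Set} (K? : Decidable K) A x → Separated d 0 K (A ∷ʳ x) →
                         Greedy d (A ∷ʳ x) → ∀ {P′ c R′} → filter K? (A ∷ʳ x) ≡ P′ ++ c ∷ R′ →
                         cost d c P′ ≤ cost d x A
  filter-greedy-≤-last K? A x sep greedy {c = c} eq
    with P , R , L≡ , refl , _ , Kc ← filter-split K? (A ∷ʳ x) eq =
    subst (_≤ cost d x A) (sym restrict) (greedy-≤-last A x P c R greedy L≡)
    where
    in-L : ∀ {u} → u ∈ P ++ c ∷ R → u ∈ A ∷ʳ x
    in-L = subst (_ ∈_) (sym L≡)
    restrict : cost d c (filter K? P) ≡ cost d c P
    restrict = cost-filter d K? P (λ p∈P ¬Kp →
      n≤0⇒n≡0 (sep (in-L (∈-++⁺ʳ P (here refl))) (in-L (∈-++⁺ˡ p∈P)) Kc ¬Kp))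

GreedyBound : Set → ℕ → Set
GreedyBound X n = ∀ {d : X → X → ℕ} → IsCloseness d → ∀ A x → length A ≤ n → Greedy d (A ∷ʳ x) →
  ∀ Y → length Y ≡ length A → ∃[ z ] z ∈ A ∷ʳ x × cost d z Y ≤ cost d x A

module _ {d : X → X → ℕ} (isC : IsCloseness d) {A x} (greedy : Greedy d (A ∷ʳ x))
         {m} (m≤ : ∀ {z p} → z ∈ A ∷ʳ x → p ∈ A ∷ʳ x → m ≤ d z p) where

  private
    d′ : X → X → ℕ
    d′ = d ∸ᶜ m

    greedy′ : Greedy d′ (A ∷ʳ x)
    greedy′ = greedy-∸ d m≤ greedy

  -- The induction step: after subtracting m, only the part K of the sequence and the points
  -- Q of Y near it count, and K is a shorter greedy sequence.
  cluster-bound : ∀ {n} → GreedyBound X n →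
    ∀ {K : X → Set} (K? : Decidable K) → Separated d m K (A ∷ʳ x) →
    ∀ Y {Q : X → Set} (Q? : Decidable Q) →
    (∀ {z y} → z ∈ A ∷ʳ x → K z → y ∈ Y → ¬ Q y → d z y ≤ m) →
    length (filter Q? Y) < length (filter K? (A ∷ʳ x)) → length (filter K? (A ∷ʳ x)) ≤ suc n →
    length Y ≡ length A → ∃[ z ] z ∈ A ∷ʳ x × cost d z Y ≤ cost d x A
  cluster-bound bound K? sep Y Q? far |Q|<|K| |K|≤ |Y|≡
    with P , c , R , split , |P|≡ ← split-at (filter K? (A ∷ʳ x)) |Q|<|K|
    with z , z∈ , z-bound ← bound (isCloseness-∸ m isC) P c
           (≤-pred (subst (_< suc _) (sym |P|≡) (≤-trans |Q|<|K| |K|≤)))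
           (greedy-prefix d′ P c R (subst (Greedy d′) split (greedy-filter d′ K? (separated-∸ sep) greedy′)))
           (filter Q? Y) (sym |P|≡)
    with z∈L , Kz ← ∈-filter⁻ K? (subst (z ∈_) (sym split) (∈-∷ʳ⇒∈-++-∷ P R z∈)) =
    z , z∈L , (begin
      cost d z Y                             ≤⟨ cost-∸ d z m Y ⟩
      length Y * m + cost d′ z Y             ≡⟨ cong₂ (λ l e → l * m + e) |Y|≡ z-cost ⟩
      length A * m + cost d′ z (filter Q? Y) ≤⟨ +-monoʳ-≤ (length A * m) (≤-trans z-bound c-bound) ⟩
      length A * m + cost d′ x A             ≡⟨ x-cost ⟨
      cost d x A                             ∎)
    where
    open ≤-Reasoning
    z-cost : cost d′ z Y ≡ cost d′ z (filter Q? Y)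
    z-cost = sym (cost-filter d′ Q? Y (λ y∈ ¬Qy → m≤n⇒m∸n≡0 (far z∈L Kz y∈ ¬Qy)))
    x-cost : cost d x A ≡ length A * m + cost d′ x A
    x-cost = cost-∸-exact d A (All.tabulate (λ a∈A → m≤ (∈-++⁺ʳ A (here refl)) (∈-++⁺ˡ a∈A)))
    c-bound : cost d′ c P ≤ cost d′ x A
    c-bound = filter-greedy-≤-last d′ K? A x (separated-∸ sep) greedy′ split

greedy-bound : ∀ {X} n → GreedyBound X n
greedy-bound _       isC []       x _  _      []      _    = x , here refl , z≤n
greedy-bound zero    isC (_ ∷ _)  x ()
greedy-bound {X} (suc n) {d} isC (a₀ ∷ A) x |A₀|≤ greedy Y |Y|≡ = by-cases (m <? d a₀ a₀)
  where
  open IsCloseness isC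
  A₀ L : List X
  A₀ = a₀ ∷ A
  L  = A₀ ∷ʳ x

  p₀ : X
  p₀ = argmin (d a₀) a₀ (A ∷ʳ x)

  m : ℕ
  m = d a₀ p₀

  p₀∈L : p₀ ∈ L
  p₀∈L = argmin-all (d a₀) {P = _∈ L} (here refl) (All.tabulate there)

  m≤a₀ : ∀ {p} → p ∈ L → m ≤ d a₀ p
  m≤a₀ (here refl) = f[argmin]≤f[⊤] {f = d a₀} a₀ (A ∷ʳ x)
  m≤a₀ (there p∈)  = All.lookup (f[argmin]≤f[xs] {f = d a₀} a₀ (A ∷ʳ x)) p∈

  m≤ : ∀ {z p} → z ∈ L → p ∈ L → m ≤ d z p
  m≤ {z} {p} z∈ p∈ =
    ≤-trans (⊓-glb (subst (m ≤_) (symmetric a₀ z) (m≤a₀ z∈)) (m≤a₀ p∈)) (ultrametric z a₀ p)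

  K : X → Set
  K y = m < d a₀ y
  K? : Decidable K
  K? y = m <? d a₀ y

  Q : X → Set
  Q y = Any (λ z → m < d z y) (filter K? L)
  Q? : Decidable Q
  Q? y = any? (λ z → m <? d z y) (filter K? L)

  sep : Separated d m K L
  sep {z} {p} _ _ Kz ¬Kp = ≮⇒≥ (λ m<dzp → ¬Kp (<-≤-trans (⊓-glb Kz m<dzp) (ultrametric a₀ z p)))

  sep∁ : Separated d m (∁ K) L
  sep∁ {z} {p} z∈ p∈ ¬Kz ¬¬Kp =
    subst (_≤ m) (symmetric p z) (sep p∈ z∈ (decidable-stable (K? p) ¬¬Kp) ¬Kz)

  far : ∀ {z y} → z ∈ L → K z → y ∈ Y → ¬ Q y → d z y ≤ m
  far z∈ Kz _ ¬Qy = ≮⇒≥ (λ m<dzy → ¬Qy (lose (∈-filter⁺ K? z∈ Kz) m<dzy))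

  far∁ : ∀ {z y} → z ∈ L → ¬ K z → y ∈ Y → ¬ ¬ Q y → d z y ≤ m
  far∁ {z} {y} z∈ ¬Kz _ ¬¬Qy with z′ , z′∈ , m<dz′y ← find (decidable-stable (Q? y) ¬¬Qy)
    with z′∈L , Kz′ ← ∈-filter⁻ K? z′∈ =
    ≮⇒≥ (λ m<dzy → <⇒≱ (<-≤-trans (⊓-glb m<dz′y (subst (m <_) (symmetric z y) m<dzy)) (ultrametric z′ y z))
                        (sep z′∈L z∈ Kz′ ¬Kz))

  splitK : length (filter K? L) + length (filter (∁? K?) L) ≡ suc (length A₀)
  splitK = trans (length-filter-∁ K? L) (trans (length-++ A₀) (+-comm (length A₀) 1))

  splitQ : length (filter Q? Y) + length (filter (∁? Q?) Y) ≡ length A₀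
  splitQ = trans (length-filter-∁ Q? Y) |Y|≡

  ≤-of-sum : ∀ {a b c} → a + b ≡ suc c → 0 < b → a ≤ c
  ≤-of-sum {a} eq 0<b = ≤-pred (≤-trans (≤-reflexive (+-comm 1 a)) (≤-trans (+-monoʳ-≤ a 0<b) (≤-reflexive eq)))

  |K|≤ : length (filter K? L) ≤ suc n
  |K|≤ = ≤-trans (≤-of-sum splitK (filter-some (∁? K?) (lose p₀∈L (n≮n m)))) |A₀|≤

  |∁K|≤ : K a₀ → length (filter (∁? K?) L) ≤ suc n
  |∁K|≤ Ka₀ = ≤-trans (≤-of-sum (trans (+-comm _ (length (filter K? L))) splitK)
                                 (filter-some K? (lose (here refl) Ka₀))) |A₀|≤

  x∈L : x ∈ L
  x∈L = ∈-++⁺ʳ A₀ (here refl)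

  by-cases : Dec (m < d a₀ a₀) → ∃[ z ] z ∈ L × cost d z Y ≤ cost d x A₀
  by-cases (no m≮) = a₀ , here refl , (begin
    cost d a₀ Y                        ≤⟨ cost-≤-* d Y (All.tabulate (λ _ → ≤-trans (≤-diagonal a₀ _) (≮⇒≥ m≮))) ⟩
    length Y * m                       ≡⟨ cong (_* m) |Y|≡ ⟩
    length A₀ * m                      ≤⟨ m≤m+n _ _ ⟩
    length A₀ * m + cost (d ∸ᶜ m) x A₀ ≡⟨ cost-∸-exact d A₀ (All.tabulate (λ a∈ → m≤ x∈L (∈-++⁺ˡ a∈))) ⟨
    cost d x A₀                        ∎)
    where open ≤-Reasoning
  by-cases (yes m<) with length (filter Q? Y) <? length (filter K? L)
  ... | yes |Q|<|K| = cluster-bound isC greedy m≤ (greedy-bound n) K? sep Y Q? far |Q|<|K| |K|≤ |Y|≡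
  ... | no  |Q|≮|K| =
    cluster-bound isC greedy m≤ (greedy-bound n) (∁? K?) sep∁ Y (∁? Q?) far∁ |∁Q|<|∁K| (|∁K|≤ m<) |Y|≡
    where
    open ≤-Reasoning
    |∁Q|<|∁K| : length (filter (∁? Q?) Y) < length (filter (∁? K?) L)
    |∁Q|<|∁K| = +-cancelˡ-≤ (length (filter K? L)) _ _ (begin
      length (filter K? L) + suc (length (filter (∁? Q?) Y)) ≡⟨ +-suc _ _ ⟩
      suc (length (filter K? L) + length (filter (∁? Q?) Y)) ≤⟨ s≤s (+-monoˡ-≤ _ (≮⇒≥ |Q|≮|K|)) ⟩
      suc (length (filter Q? Y) + length (filter (∁? Q?) Y)) ≡⟨ cong suc splitQ ⟩
      suc (length A₀)                                        ≡⟨ splitK ⟨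
      length (filter K? L) + length (filter (∁? K?) L)       ∎)

≤∞-trans : ∀ {x y z} → x ≤∞ y → y ≤∞ z → x ≤∞ z
≤∞-trans x≤y y≤z n zn = x≤y n (y≤z n zn)

≈∞-sym : ∀ {x y} → x ≈∞ y → y ≈∞ x
≈∞-sym (x≤y , y≤x) = y≤x , x≤y

≈∞-trans : ∀ {x y z} → x ≈∞ y → y ≈∞ z → x ≈∞ z
≈∞-trans (x≤y , y≤x) (y≤z , z≤y) = ≤∞-trans x≤y y≤z , ≤∞-trans z≤y y≤x

+∞-mono : ∀ {x x′ y y′} → x ≤∞ x′ → y ≤∞ y′ → (x +∞ y) ≤∞ (x′ +∞ y′)
+∞-mono x≤ y≤ n (i , j , x′i , y′j , i+j≤n) = i , j , x≤ i x′i , y≤ j y′j , i+j≤n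

sum∞-mono : ∀ {g h} → (∀ j → g j ≤∞ h j) → ∀ k → sum∞ k g ≤∞ sum∞ k h
sum∞-mono g≤h zero    n _ = tt
sum∞-mono g≤h (suc k)     = +∞-mono (sum∞-mono g≤h k) (g≤h k)

sum∞-cong : ∀ {g h} → (∀ j → g j ≈∞ h j) → ∀ k → sum∞ k g ≈∞ sum∞ k h
sum∞-cong g≈h k = sum∞-mono (proj₁ ∘ g≈h) k , sum∞-mono (proj₂ ∘ g≈h) k

Represents : ℕ → ℕ∞ → ℕ → Set
Represents N x c = ∀ {n} → n ≤ N → x n ⇔ c ≤ n

+∞-represents : ∀ {N x y c e} → Represents N x c → Represents N y e → Represents N (x +∞ y) (c + e)
+∞-represents {N} {c = c} {e} rx ry {n} n≤N = mk⇔
  (λ (i , j , xi , yj , i+j≤n) → ≤-trans (+-mono-≤ (to (rx (bound (m≤m+n i j) i+j≤n)) xi)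
                                                  (to (ry (bound (m≤n+m j i) i+j≤n)) yj)) i+j≤n)
  (λ c+e≤n → c , e , from (rx (bound (m≤m+n c e) c+e≤n)) ≤-refl
                   , from (ry (bound (m≤n+m e c) c+e≤n)) ≤-refl , c+e≤n)
  where
  bound : ∀ {i s} → i ≤ s → s ≤ n → i ≤ N
  bound i≤s s≤n = ≤-trans i≤s (≤-trans s≤n n≤N)

sum∞-represents : ∀ {N g h} → (∀ j → Represents N (g j) (h j)) →
                  ∀ k → Represents N (sum∞ k g) (sum (applyUpTo h k))
sum∞-represents r zero    _ = mk⇔ (λ _ → z≤n) (λ _ → tt)
sum∞-represents {h = h} r (suc k) =
  subst (Represents _ _) sum-∷ʳ (+∞-represents (sum∞-represents r k) (r k))
  where
  sum-∷ʳ : sum (applyUpTo h k) + h k ≡ sum (applyUpTo h (suc k))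
  sum-∷ʳ = trans (cong (sum (applyUpTo h k) +_) (sym (+-identityʳ (h k))))
                 (trans (sym (sum-++ (applyUpTo h k) [ h k ])) (cong sum (applyUpTo-∷ʳ h k)))

-- Truncated b-adic valuation

module _ (b : ℕ) where

  -- ord_b(n) truncated at M; in particular val M 0 = M.
  val : ℕ → ℕ → ℕ
  val zero    n = 0
  val (suc M) n with b ^ suc M ∣? n
  ... | yes _ = suc M
  ... | no  _ = val M n

  val-≤ : ∀ M n → val M n ≤ M
  val-≤ zero    n = z≤n
  val-≤ (suc M) n with b ^ suc M ∣? n
  ... | yes _ = ≤-refl
  ... | no  _ = m≤n⇒m≤1+n (val-≤ M n)

  ^val∣ : ∀ M n → b ^ val M n ∣ n
  ^val∣ zero    n = 1∣ n
  ^val∣ (suc M) n with b ^ suc M ∣? n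
  ... | yes b^M∣n = b^M∣n
  ... | no  _     = ^val∣ M n

  ≤-val : ∀ {M n j} → j ≤ M → b ^ j ∣ n → j ≤ val M n
  ≤-val {zero}          j≤M _ = j≤M
  ≤-val {suc M} {n} {j} j≤M b^j∣n with b ^ suc M ∣? n | m≤n⇒m<n∨m≡n j≤M
  ... | yes _     | _          = j≤M
  ... | no  _     | inj₁ j<1+M = ≤-val (s≤s⁻¹ j<1+M) b^j∣n
  ... | no  b^M∤n | inj₂ refl  = contradiction b^j∣n b^M∤n

  ^-∣-^ : ∀ {j k} → j ≤ k → b ^ j ∣ b ^ k
  ^-∣-^ {j} {k} j≤k =
    subst (b ^ j ∣_) (trans (sym (^-distribˡ-+-* b j (k ∸ j))) (cong (b ^_) (m+[n∸m]≡n j≤k))) (m∣m*n (b ^ (k ∸ j)))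

  dist : ℕ → ℤ → ℤ → ℕ
  dist M x y = val M ℤ.∣ x ℤ.- y ∣

  isCloseness-dist : ∀ M → IsCloseness (dist M)
  isCloseness-dist M = record
    { symmetric   = λ x y → cong (val M) (∣x-y∣≡∣y-x∣ x y)
    ; ultrametric = ultrametric
    ; ≤-diagonal  = λ x y → ≤-trans (val-≤ M _) (≤-val ≤-refl (subst (b ^ M ∣_) (∣x-x∣≡0 x) (_ ∣0)))
    }
    where
    open +-*-Solver
    ∣x-y∣≡∣y-x∣ : ∀ x y → ℤ.∣ x ℤ.- y ∣ ≡ ℤ.∣ y ℤ.- x ∣
    ∣x-y∣≡∣y-x∣ x y = trans (sym (ℤP.∣-i∣≡∣i∣ (x ℤ.- y)))
                            (cong ℤ.∣_∣ (solve 2 (λ x y → :- (x :- y) := y :- x) refl x y))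
    ∣x-x∣≡0 : ∀ x → 0 ≡ ℤ.∣ x ℤ.- x ∣
    ∣x-x∣≡0 x = sym (cong ℤ.∣_∣ (ℤP.+-inverseʳ x))
    pow∣ : ∀ {j} w → j ≤ val M ℤ.∣ w ∣ → ℤ.+ (b ^ j) ℤS.∣ w
    pow∣ {j} w j≤ = ℤS.∣ᵤ⇒∣ {ℤ.+ (b ^ j)} {w} (∣-trans (^-∣-^ j≤) (^val∣ M ℤ.∣ w ∣))
    ultrametric : ∀ x y z → dist M x y ⊓ dist M y z ≤ dist M x z
    ultrametric x y z = ≤-val (≤-trans (m⊓n≤m _ _) (val-≤ M _)) (ℤS.∣⇒∣ᵤ {ℤ.+ (b ^ j)}
      (subst (ℤ.+ (b ^ j) ℤS.∣_) (solve 3 (λ x y z → (x :- y) :+ (y :- z) := x :- z) refl x y z)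
        (ℤS.∣m∣n⇒∣m+n (pow∣ (x ℤ.- y) (m⊓n≤m _ (dist M y z))) (pow∣ (y ℤ.- z) (m⊓n≤n (dist M x y) _)))))
      where
      j : ℕ
      j = dist M x y ⊓ dist M y z

  pos-^ : ∀ k → (ℤ.+ b) ℤ.^ k ≡ ℤ.+ (b ^ k)
  pos-^ zero    = refl
  pos-^ (suc k) = trans (cong (ℤ.+ b ℤ.*_) (pos-^ k)) (sym (ℤP.pos-* b (b ^ k)))

  ordb-represents : ∀ N z → Represents N (ordb b z) (val (suc N) ℤ.∣ z ∣)
  ordb-represents N z {n} n≤N = mk⇔
    (λ ord → ord v (subst (_∣ ℤ.∣ z ∣) (sym (cong ℤ.∣_∣ (pos-^ v))) (^val∣ (suc N) ℤ.∣ z ∣)))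
    (λ v≤n k b^k∣z → bounded k v≤n (subst (_∣ ℤ.∣ z ∣) (cong ℤ.∣_∣ (pos-^ k)) b^k∣z))
    where
    v : ℕ
    v = val (suc N) ℤ.∣ z ∣
    bounded : ∀ k → v ≤ n → b ^ k ∣ ℤ.∣ z ∣ → k ≤ n
    bounded k v≤n b^k∣z with k ≤? suc N
    ... | yes k≤ = ≤-trans (≤-val k≤ b^k∣z) v≤n
    ... | no  k≰ = contradiction
      (≤-trans (≤-val ≤-refl (∣-trans (^-∣-^ (<⇒≤ (≰⇒> k≰))) b^k∣z)) (≤-trans v≤n n≤N)) (n≮n N)

  bsum-represents : ∀ N a i x → Represents N (bsum b a i x) (cost (dist (suc N)) x (applyUpTo a i))
  bsum-represents N a i x = subst (Represents N _) (cong sum (sym (map-applyUpTo a (dist (suc N) x) i)))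
    (sum∞-represents (λ j → ordb-represents N (x ℤ.- a j)) i)

module _ {b : ℕ} {S : ℤ → Set} {a : ℕ → ℤ} (isOrd : IsBOrdering b S a) (N : ℕ) where

  private
    d : ℤ → ℤ → ℕ
    d = dist b (suc N)

    C : ℕ → ℤ → ℕ
    C i x = cost d x (applyUpTo a i)

    C-minimal : ∀ {i x} → 1 ≤ i → S x → C i x ≤ N → C i (a i) ≤ C i x
    C-minimal {i} {x} 1≤i Sx Cx≤N =
      to (bsum-represents b N a i (a i) Cx≤N)
         (proj₂ isOrd i 1≤i x Sx _ (from (bsum-represents b N a i x Cx≤N) ≤-refl))

    C-≤-suc : ∀ i x → C i x ≤ C (suc i) x
    C-≤-suc i x = subst (λ L → C i x ≤ cost d x L) (applyUpTo-∷ʳ a i) (cost-≤-++ d x (applyUpTo a i) [ a i ])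

    C-nondecreasing : ∀ i → C (suc i) (a (suc i)) ≤ N → C i (a i) ≤ C (suc i) (a (suc i))
    C-nondecreasing zero    _   = z≤n
    C-nondecreasing (suc i) C≤N =
      ≤-trans (C-minimal (s≤s z≤n) (proj₁ isOrd (2 + i)) (≤-trans (C-≤-suc (suc i) (a (2 + i))) C≤N))
              (C-≤-suc (suc i) (a (2 + i)))

    C-bounded : ∀ {i k} → i ≤ k → C k (a k) ≤ N → C i (a i) ≤ N
    C-bounded {k = zero}  z≤n C≤N = C≤N
    C-bounded {k = suc k} i≤k C≤N with m≤n⇒m<n∨m≡n i≤k
    ... | inj₁ i<1+k = C-bounded (s≤s⁻¹ i<1+k) (≤-trans (C-nondecreasing k C≤N) C≤N)
    ... | inj₂ refl  = C≤N

  greedy-truncated : ∀ k → C k (a k) ≤ N → Greedy d (applyUpTo a (suc k))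
  greedy-truncated k C≤N P x R eq z∈R
    with i , i<1+k , refl , refl , later ← applyUpTo-split a (suc k) eq
    with l , i<l , l<1+k , refl ← later z∈R = at i i<l
    where
    at : ∀ i → i < l → C i (a i) ≤ C i (a l)
    at zero    _   = z≤n
    at (suc i) i<l with C (suc i) (a l) ≤? N
    ... | yes C≤ = C-minimal (s≤s z≤n) (proj₁ isOrd l) C≤
    ... | no  C≰ = ≤-trans (C-bounded (≤-trans (<⇒≤ i<l) (s≤s⁻¹ l<1+k)) C≤N) (<⇒≤ (≰⇒> C≰))

αb-≤ : ∀ {b S a a′} → IsBOrdering b S a → IsBOrdering b S a′ → ∀ k → 1 ≤ k → αb b a′ k ≤∞ αb b a k
αb-≤ {b} {S} {a} {a′} isOrd isOrd′ k 1≤k N αa≤N =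
  let z , z∈ , z-cost = greedy-bound k (isCloseness-dist b (suc N)) (applyUpTo a k) (a k)
                          (≤-reflexive (length-applyUpTo a k))
                          (subst (Greedy _) (sym (applyUpTo-∷ʳ a k)) (greedy-truncated isOrd N k C≤N))
                          (applyUpTo a′ k) (trans (length-applyUpTo a′ k) (sym (length-applyUpTo a k)))
  in proj₂ isOrd′ k 1≤k z (in-S z∈) N (from (bsum-represents b N a′ k z ≤-refl) (≤-trans z-cost C≤N))
  where
  C≤N : cost (dist b (suc N)) (a k) (applyUpTo a k) ≤ N
  C≤N = to (bsum-represents b N a k (a k) ≤-refl) αa≤N
  in-S : ∀ {z} → z ∈ applyUpTo a k ∷ʳ a k → S z
  in-S z∈ with l , _ , refl ← ∈-applyUpTo⁻ a (subst (_ ∈_) (applyUpTo-∷ʳ a k) z∈) = proj₁ isOrd l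

αb-unique : ∀ {b S a a′} → IsBOrdering b S a → IsBOrdering b S a′ →
            ∀ k → 1 ≤ k → αb b a k ≈∞ αb b a′ k
αb-unique isOrd isOrd′ k 1≤k = αb-≤ isOrd′ isOrd k 1≤k , αb-≤ isOrd isOrd′ k 1≤k

-- Base-b digits and the map φ_b

/ℕ-unique : ∀ x q n .{{_ : NonZero n}} r → r < n → x ≡ ℤ.+ r ℤ.+ q ℤ.* ℤ.+ n → x /ℕ n ≡ q
/ℕ-unique x q n r r<n x≡ = ℤP.≤-antisym (below q< ([n/ℕd]*d≤n x n)) (below (n<s[n/ℕd]*d x n) qn≤x)
  where
  qn≤x : q ℤ.* ℤ.+ n ℤ.≤ x
  qn≤x = subst (q ℤ.* ℤ.+ n ℤ.≤_) (sym x≡) (ℤP.i≤j⇒i≤k+j (ℤ.+ r) ℤP.≤-refl)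
  q< : x ℤ.< ℤ.suc q ℤ.* ℤ.+ n
  q< = subst₂ ℤ._<_ (sym x≡) (sym (ℤP.suc-* q (ℤ.+ n))) (ℤP.+-monoˡ-< (q ℤ.* ℤ.+ n) (ℤ.+<+ r<n))
  below : ∀ {p p′} → x ℤ.< ℤ.suc p ℤ.* ℤ.+ n → p′ ℤ.* ℤ.+ n ℤ.≤ x → p′ ℤ.≤ p
  below x< p′n≤x = ℤP.≮⇒≥ (λ p<p′ →
    ℤP.<⇒≱ x< (ℤP.≤-trans (ℤP.*-monoʳ-≤-nonNeg (ℤ.+ n) (ℤP.i<j⇒suc[i]≤j p<p′)) p′n≤x))

/ℕ-+-* : ∀ x c n .{{_ : NonZero n}} → (x ℤ.+ c ℤ.* ℤ.+ n) /ℕ n ≡ x /ℕ n ℤ.+ c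
/ℕ-+-* x c n = /ℕ-unique _ _ n (x %ℕ n) (n%ℕd<d x n)
  (trans (cong (ℤ._+ c ℤ.* ℤ.+ n) (a≡a%ℕn+[a/ℕn]*n x n))
         (solve 4 (λ r q c n → (r :+ q :* n) :+ c :* n := r :+ (q :+ c) :* n) refl
                (ℤ.+ (x %ℕ n)) (x /ℕ n) c (ℤ.+ n)))
  where open +-*-Solver

/ℕ-1 : ∀ x → x /ℕ 1 ≡ x
/ℕ-1 x = /ℕ-unique x x 1 0 (s≤s z≤n) (sym (trans (ℤP.+-identityˡ _) (ℤP.*-identityʳ x)))

/1-injective : ∀ {p q} → p ℚ./ 1 ≡ q ℚ./ 1 → p ≡ q
/1-injective {p} {q} eq with ℚP./-injective-≃ (mkℚᵘ p 0) (mkℚᵘ q 0) eq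
... | *≡* p*1≡q*1 = trans (sym (ℤP.*-identityʳ p)) (trans p*1≡q*1 (ℤP.*-identityʳ q))

p/1-q/1≡0⇔p≡q : ∀ p q → (p ℚ./ 1) ℚ.- (q ℚ./ 1) ≡ ℚ.0ℚ ⇔ p ≡ q
p/1-q/1≡0⇔p≡q p q = mk⇔ (λ eq → /1-injective (x∙y⁻¹≈ε⇒x≈y _ _ eq))
                        (λ p≡q → x≈y⇒x∙y⁻¹≈ε (cong (ℚ._/ 1) p≡q))

module _ (b : ℕ) (hb : 2 ≤ b) where

  private
    -- floorDiv uses a private NonZero proof of Defs; instance arguments are irrelevant, so any proof will do.
    b^k-nonZero : ∀ k → NonZero (b ^ k)
    b^k-nonZero k = m^n≢0 b k {{>-nonZero (≤-trans (s≤s z≤n) hb)}}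

    F : ℤ → ℕ → ℤ
    F = floorDiv b hb

    open +-*-Solver

  F-shift : ∀ a′ c i j → F (a′ ℤ.+ c ℤ.* ℤ.+ (b ^ (j + i))) i ≡ F a′ i ℤ.+ c ℤ.* ℤ.+ (b ^ j)
  F-shift a′ c i j =
    trans (cong (λ u → F u i) regroup) (/ℕ-+-* a′ (c ℤ.* ℤ.+ (b ^ j)) (b ^ i) {{b^k-nonZero i}})
    where
    open ≡-Reasoning
    regroup : a′ ℤ.+ c ℤ.* ℤ.+ (b ^ (j + i)) ≡ a′ ℤ.+ (c ℤ.* ℤ.+ (b ^ j)) ℤ.* ℤ.+ (b ^ i)
    regroup = begin
      a′ ℤ.+ c ℤ.* ℤ.+ (b ^ (j + i))             ≡⟨ cong (λ u → a′ ℤ.+ c ℤ.* ℤ.+ u) (^-distribˡ-+-* b j i) ⟩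
      a′ ℤ.+ c ℤ.* ℤ.+ (b ^ j * b ^ i)           ≡⟨ cong (λ u → a′ ℤ.+ c ℤ.* u) (ℤP.pos-* (b ^ j) (b ^ i)) ⟩
      a′ ℤ.+ c ℤ.* (ℤ.+ (b ^ j) ℤ.* ℤ.+ (b ^ i)) ≡⟨ cong (λ u → a′ ℤ.+ u) (ℤP.*-assoc c _ _) ⟨
      a′ ℤ.+ (c ℤ.* ℤ.+ (b ^ j)) ℤ.* ℤ.+ (b ^ i) ∎

  digit-shift : ∀ a′ c i j → digit b hb (a′ ℤ.+ c ℤ.* ℤ.+ (b ^ suc (j + i))) i ≡ digit b hb a′ i
  digit-shift a′ c i j = begin
    F a i ℤ.- B ℤ.* F a (suc i)
      ≡⟨ cong₂ (λ u w → u ℤ.- B ℤ.* w) (F-shift a′ c i (suc j))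
               (trans (cong (λ e → F (a′ ℤ.+ c ℤ.* ℤ.+ (b ^ e)) (suc i)) (sym (+-suc j i)))
                      (F-shift a′ c (suc i) j)) ⟩
    (F a′ i ℤ.+ c ℤ.* ℤ.+ (b * b ^ j)) ℤ.- B ℤ.* (F a′ (suc i) ℤ.+ c ℤ.* T)
      ≡⟨ cong (λ u → (F a′ i ℤ.+ c ℤ.* u) ℤ.- B ℤ.* (F a′ (suc i) ℤ.+ c ℤ.* T)) (ℤP.pos-* b (b ^ j)) ⟩
    (F a′ i ℤ.+ c ℤ.* (B ℤ.* T)) ℤ.- B ℤ.* (F a′ (suc i) ℤ.+ c ℤ.* T)
      ≡⟨ solve 5 (λ f g c B t → (f :+ c :* (B :* t)) :- B :* (g :+ c :* t) := f :- B :* g) refl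
               (F a′ i) (F a′ (suc i)) c B T ⟩
    F a′ i ℤ.- B ℤ.* F a′ (suc i) ∎
    where
    open ≡-Reasoning
    a B T : ℤ
    a = a′ ℤ.+ c ℤ.* ℤ.+ (b ^ suc (j + i))
    B = ℤ.+ b
    T = ℤ.+ (b ^ j)

  pow∣⇒digits-agree : ∀ {a a′ k} → (ℤ.+ b) ℤ.^ k ℤD.∣ (a ℤ.- a′) →
                      ∀ i → i < k → digit b hb a i ≡ digit b hb a′ i
  pow∣⇒digits-agree {a} {a′} {k} b^k∣ i i<k
    with ℤS.divides c a-a′≡ ← ℤS.∣ᵤ⇒∣ {(ℤ.+ b) ℤ.^ k} {a ℤ.- a′} b^k∣ =
    trans (cong (λ u → digit b hb u i) a≡) (digit-shift a′ c i (k ∸ suc i))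
    where
    open ≡-Reasoning
    k≡ : k ≡ suc (k ∸ suc i + i)
    k≡ = trans (sym (m+[n∸m]≡n i<k)) (trans (+-comm (suc i) (k ∸ suc i)) (+-suc (k ∸ suc i) i))
    a≡ : a ≡ a′ ℤ.+ c ℤ.* ℤ.+ (b ^ suc (k ∸ suc i + i))
    a≡ = begin
      a                                          ≡⟨ solve 2 (λ a a′ → a := a′ :+ (a :- a′)) refl a a′ ⟩
      a′ ℤ.+ (a ℤ.- a′)                          ≡⟨ cong (λ u → a′ ℤ.+ u) a-a′≡ ⟩
      a′ ℤ.+ c ℤ.* (ℤ.+ b) ℤ.^ k                 ≡⟨ cong (λ u → a′ ℤ.+ c ℤ.* u) (pos-^ b k) ⟩
      a′ ℤ.+ c ℤ.* ℤ.+ (b ^ k)                   ≡⟨ cong (λ e → a′ ℤ.+ c ℤ.* ℤ.+ (b ^ e)) k≡ ⟩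
      a′ ℤ.+ c ℤ.* ℤ.+ (b ^ suc (k ∸ suc i + i)) ∎

  digits-agree⇒pow∣ : ∀ {a a′} k → (∀ i → i < k → digit b hb a i ≡ digit b hb a′ i) →
                      (ℤ.+ b) ℤ.^ k ℤD.∣ (a ℤ.- a′)
  digits-agree⇒pow∣ {a} {a′} k agree =
    ℤS.∣⇒∣ᵤ {(ℤ.+ b) ℤ.^ k} {a ℤ.- a′} (ℤS.divides (D k) (trans (a-a′≡ k ≤-refl) (ℤP.*-comm _ (D k))))
    where
    D : ℕ → ℤ
    D j = F a j ℤ.- F a′ j
    D-step : ∀ i → i < k → D i ≡ ℤ.+ b ℤ.* D (suc i)
    D-step i i<k = ℤP.i-j≡0⇒i≡j _ _ (trans
      (solve 5 (λ f f′ g g′ B → (f :- f′) :- B :* (g :- g′) := (f :- B :* g) :- (f′ :- B :* g′)) refl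
             (F a i) (F a′ i) (F a (suc i)) (F a′ (suc i)) (ℤ.+ b))
      (ℤP.i≡j⇒i-j≡0 (agree i i<k)))
    a-a′≡ : ∀ j → j ≤ k → a ℤ.- a′ ≡ (ℤ.+ b) ℤ.^ j ℤ.* D j
    a-a′≡ zero    _   = sym (trans (ℤP.*-identityˡ _) (cong₂ ℤ._-_ (/ℕ-1 a) (/ℕ-1 a′)))
    a-a′≡ (suc j) j<k = trans (a-a′≡ j (<⇒≤ j<k)) (trans (cong ((ℤ.+ b) ℤ.^ j ℤ.*_) (D-step j j<k))
      (solve 3 (λ p B d → p :* (B :* d) := (B :* p) :* d) refl ((ℤ.+ b) ℤ.^ j) (ℤ.+ b) (D (suc j))))

  tPowDivides⇔pow∣ : ∀ {f g} x y → (∀ k → f k ≡ φ b hb x k) → (∀ k → g k ≡ φ b hb y k) →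
                     ∀ k → tPowDivides k (f -ps g) ⇔ (ℤ.+ b) ℤ.^ k ℤD.∣ (x ℤ.- y)
  tPowDivides⇔pow∣ {f} {g} x y f≐ g≐ k = mk⇔
    (λ t^k∣ → digits-agree⇒pow∣ {x} {y} k (λ i i<k → to (coeff≡0⇔ i) (t^k∣ i i<k)))
    (λ b^k∣ i i<k → from (coeff≡0⇔ i) (pow∣⇒digits-agree {x} {y} b^k∣ i i<k))
    where
    coeff≡0⇔ : ∀ i → f i ℚ.- g i ≡ ℚ.0ℚ ⇔ digit b hb x i ≡ digit b hb y i
    coeff≡0⇔ i = subst (λ q → q ≡ ℚ.0ℚ ⇔ digit b hb x i ≡ digit b hb y i)
                       (sym (cong₂ ℚ._-_ (f≐ i) (g≐ i))) (p/1-q/1≡0⇔p≡q (digit b hb x i) (digit b hb y i))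

  ordt≈ordb : ∀ {f g} x y → (∀ k → f k ≡ φ b hb x k) → (∀ k → g k ≡ φ b hb y k) →
              ordt (f -ps g) ≈∞ ordb b (x ℤ.- y)
  ordt≈ordb x y f≐ g≐ = (λ n ord k t^k∣ → ord k (to (tPowDivides⇔pow∣ x y f≐ g≐ k) t^k∣))
                      , (λ n ord k b^k∣ → ord k (from (tPowDivides⇔pow∣ x y f≐ g≐ k) b^k∣))

module _ {b : ℕ} {hb : 2 ≤ b} {S : ℤ → Set} {f : ℕ → PS} (isTOrd : IsTOrdering (image b hb S) f) where

  preimage : ℕ → ℤ
  preimage i = proj₁ (proj₁ isTOrd i)

  private
    φ-preimage : ∀ i k → f i k ≡ φ b hb (preimage i) k
    φ-preimage i = proj₂ (proj₂ (proj₁ isTOrd i))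

    tsum≈bsum : ∀ {g} x → (∀ k → g k ≡ φ b hb x k) → ∀ i → tsum f i g ≈∞ bsum b preimage i x
    tsum≈bsum x g≐ = sum∞-cong (λ j → ordt≈ordb b hb x (preimage j) g≐ (φ-preimage j))

  preimage-isBOrdering : IsBOrdering b S preimage
  preimage-isBOrdering = (λ i → proj₁ (proj₂ (proj₁ isTOrd i))) , λ i 1≤i x Sx →
    ≤∞-trans (proj₂ (tsum≈bsum (preimage i) (φ-preimage i) i))
      (≤∞-trans (proj₂ isTOrd i 1≤i (φ b hb x) (x , Sx , λ _ → refl))
                (proj₁ (tsum≈bsum x (λ _ → refl) i)))

  αt≈αb-preimage : ∀ k → αt f k ≈∞ αb b preimage k
  αt≈αb-preimage k = tsum≈bsum (preimage k) (φ-preimage k) k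

theorem5p3 : (b : ℕ) (hb : 2 ≤ b) (S : ℤ → Set) → ∃ S →
    ((a a′ : ℕ → ℤ) → IsBOrdering b S a → IsBOrdering b S a′ →
       ∀ k → 1 ≤ k → αb b a k ≈∞ αb b a′ k)
    × ((a : ℕ → ℤ) (f : ℕ → PS) → IsBOrdering b S a →
       IsTOrdering (image b hb S) f →
       ∀ k → 1 ≤ k → αb b a k ≈∞ αt f k)
theorem5p3 b hb S _ =
  (λ a a′ → αb-unique) ,
  λ a f isOrd isTOrd k 1≤k →
    ≈∞-trans (αb-unique isOrd (preimage-isBOrdering {hb = hb} isTOrd) k 1≤k)
             (≈∞-sym (αt≈αb-preimage {hb = hb} isTOrd k))
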